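{- Every infinite connected component $C$ of $\Gamma_{\mathrm{NS}}$ satisfies: for every finite $F\subseteq C\cap U^{\Gamma_{\mathrm{NS}}}$ there exists $v\in C\cap V^{\Gamma_{\mathrm{NS}}}$ such that $u\,E^{\Gamma_{\mathrm{NS}}}\,v$ for every $u\in F$.
   Context: Let $L=\{E,U,V\}$ with $E$ binary and $U,V$ unary; an $L$-structure $M$ is a bipartite graph if $U^M\cup V^M=|M|$, $U^M\cap V^M=\emptyset$, and $xE^My$ implies $x\in U^M$, $y\in V^M$. For $n,k\in\omega$, $\Delta_{n,k}$ is the bipartite graph with $U=\{1,\dots,n\}$, $V=[\{1,\dots,n\}]^{\le k}\setminus\{\emptyset\}$, and $uEv$ iff $u\in v$. Let $G_n=\Delta_{n^3,n}$, let $\Gamma$ be the disjoint union of $(G_n:n\ge2)$, and let $L'=L\cup\{\triangleleft\}$ where in $\Gamma$, $x\triangleleft y$ iff $x\in G_m$, $y\in G_n$ with $m<n$. $\Gamma_{\mathrm{NS}}$ is a fixed countable non-standard (proper) elementary extension of $\Gamma$ as an $L'$-structure. Connected components are taken with respect to $E$, ignoring orientation of edges. -}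

module Defs where

open import Data.Nat using (ℕ; zero; suc; _≤_; _<_; _^_)
open import Data.Fin using (Fin)
open import Data.Fin.Subset using (Subset; _∈_; ∣_∣)
open import Data.Product using (Σ; _×_; _,_)
open import Data.Sum using (_⊎_)
open import Data.Empty using (⊥)
open import Data.List using (List)
import Data.List.Membership.Propositional as LM
open import Relation.Nullary using (¬_)
open import Relation.Binary.PropositionalEquality using (_≡_; _≢_)
open import Relation.Binary.Construct.Closure.ReflexiveTransitive using (Star)
open import Function.Bundles using (_⇔_)

record Structure : Set₁ where
  field
    Carrier : Set
    E       : Carrier → Carrier → Set
    U       : Carrier → Set
    V       : Carrier → Set
    Tri     : Carrier → Carrier → Set
open Structure public

-- Formulas with at most n free variables (de Bruijn, variables are Fin n)
data Formula : ℕ → Set where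
  _≐_  : ∀ {n} → Fin n → Fin n → Formula n
  relE : ∀ {n} → Fin n → Fin n → Formula n
  relU : ∀ {n} → Fin n → Formula n
  relV : ∀ {n} → Fin n → Formula n
  relT : ∀ {n} → Fin n → Fin n → Formula n
  fls  : ∀ {n} → Formula n
  _⇒_  : ∀ {n} → Formula n → Formula n → Formula n
  _∧_  : ∀ {n} → Formula n → Formula n → Formula n
  _∨_  : ∀ {n} → Formula n → Formula n → Formula n
  all  : ∀ {n} → Formula (suc n) → Formula n
  ex   : ∀ {n} → Formula (suc n) → Formula n

extend : ∀ {A : Set} {n} → (Fin n → A) → A → Fin (suc n) → A
extend ρ a Fin.zero    = a
extend ρ a (Fin.suc i) = ρ i

Sat : (M : Structure) → ∀ {n} → Formula n → (Fin n → Carrier M) → Set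
Sat M (i ≐ j)    ρ = ρ i ≡ ρ j
Sat M (relE i j) ρ = E M (ρ i) (ρ j)
Sat M (relU i)   ρ = U M (ρ i)
Sat M (relV i)   ρ = V M (ρ i)
Sat M (relT i j) ρ = Tri M (ρ i) (ρ j)
Sat M fls        ρ = ⊥
Sat M (φ ⇒ ψ)    ρ = Sat M φ ρ → Sat M ψ ρ
Sat M (φ ∧ ψ)    ρ = Sat M φ ρ × Sat M ψ ρ
Sat M (φ ∨ ψ)    ρ = Sat M φ ρ ⊎ Sat M ψ ρ
Sat M (all φ)    ρ = (a : Carrier M) → Sat M φ (extend ρ a)
Sat M (ex φ)     ρ = Σ (Carrier M) λ a → Sat M φ (extend ρ a)

-- f : M → N is an elementary embedding (N is an elementary extension of M,
-- with M identified with its image under f)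
IsElementaryEmbedding : (M N : Structure) → (Carrier M → Carrier N) → Set
IsElementaryEmbedding M N f =
  ∀ {n} (φ : Formula n) (ρ : Fin n → Carrier M) →
    Sat M φ ρ ⇔ Sat N φ (λ i → f (ρ i))

Proper : (M N : Structure) → (Carrier M → Carrier N) → Set
Proper M N f = Σ (Carrier N) λ x → (a : Carrier M) → f a ≢ x

Countable : Structure → Set
Countable N = Σ (ℕ → Carrier N) λ e → (x : Carrier N) → Σ ℕ λ k → e k ≡ x

-- The structure Γ = disjoint union of G_n = Δ_{n^3,n}, n ≥ 2.
-- G_n is indexed by k with n = k + 2.  The U-vertices {1,…,n^3} are
-- represented by Fin (n^3); V-vertices are subsets s of Fin (n^3) with
-- 1 ≤ |s| ≤ n.

Nn : ℕ → ℕ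
Nn k = suc (suc k)

data ΓElem : Set where
  uvert : (k : ℕ) → Fin (Nn k ^ 3) → ΓElem
  vvert : (k : ℕ) (s : Subset (Nn k ^ 3)) → 1 ≤ ∣ s ∣ → ∣ s ∣ ≤ Nn k → ΓElem

index : ΓElem → ℕ
index (uvert k _)     = k
index (vvert k _ _ _) = k

data ΓE : ΓElem → ΓElem → Set where
  edge : ∀ {k i s p q} → i ∈ s → ΓE (uvert k i) (vvert k s p q)

data ΓU : ΓElem → Set where
  isU : ∀ {k i} → ΓU (uvert k i)

data ΓV : ΓElem → Set where
  isV : ∀ {k s p q} → ΓV (vvert k s p q)

ΓT : ΓElem → ΓElem → Set
ΓT x y = index x < index y

Γ : Structure
Γ = record { Carrier = ΓElem ; E = ΓE ; U = ΓU ; V = ΓV ; Tri = ΓT }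

Adj : (N : Structure) → Carrier N → Carrier N → Set
Adj N x y = E N x y ⊎ E N y x

Conn : (N : Structure) → Carrier N → Carrier N → Set
Conn N = Star (Adj N)

InfiniteComponent : (N : Structure) → Carrier N → Set
InfiniteComponent N c =
  ¬ (Σ (List (Carrier N)) λ xs → (y : Carrier N) → Conn N c y → y LM.∈ xs)

-- In Γ the relation "neither x ◁ y nor y ◁ x" says that x and y lie in the same
-- G_n, and with parameters it is first-order expressible that (a) it contains
-- the connected components, (b) below a fixed element of level K every such
-- class is one of finitely many listed elements, and (c) above that element any
-- K U-vertices of one class have a common V-neighbour, since G_n (n ≥ K) allows
-- V-vertices with up to n neighbours. All of this transfers to ΓNS. An infinite
-- component is not covered by the listed elements, so by (b) it lies above the
-- level-K element, and (c) applied to F together with one U-vertex of the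
-- component (so that the neighbour found is in the component) finishes the proof.
module Submission where

open import Defs
open import Data.Fin using (Fin; zero; suc; _↑ˡ_; _↑ʳ_)
open import Data.Fin.Subset using (Subset; ⁅_⁆; _∪_; ∣_∣; Nonempty; outside; inside) renaming (_∈_ to _∈ₛ_; ⊥ to ∅)
open import Data.Fin.Subset.Properties using (x∈⁅x⁆; ∣⁅x⁆∣≡1; ∣⊥∣≡0; ∣p∣≤∣x∷p∣; ∣p∣≤∣p∪q∣; x∈p∪q⁺)
open import Data.List using (List; []; _∷_; [_]; map; _++_; length; lookup; allFin; upTo; concatMap; cartesianProductWith)
open import Data.List.Membership.Propositional using (_∈_; lose)
open import Data.List.Membership.Propositional.Properties using (∈-map⁺; ∈-++⁺ˡ; ∈-++⁺ʳ; ∈-allFin; ∈-lookup; ∈-upTo⁺; ∈-concatMap⁺; ∈-cartesianProductWith⁺)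
open import Data.List.Relation.Unary.All as All using (All; _∷_)
open import Data.List.Relation.Unary.Any using (here; there) renaming (index to position)
open import Data.List.Relation.Unary.Any.Properties using (lookup-index)
open import Data.Nat using (ℕ; zero; suc; _+_; _^_; _≤_; _<_; z≤n; s≤s; _≤?_)
open import Data.Nat.Properties using (≤-antisym; ≮⇒≥; <-irrefl; ≤-trans; ≤-reflexive; ≤-irrelevant; m≤n+m; +-suc; +-monoʳ-≤)
open import Data.Product using (Σ; ∃; _×_; _,_; proj₁; proj₂)
import Data.Product as Product
open import Data.Sum using (inj₁; inj₂)
open import Data.Vec using ([]; _∷_; here; there)
open import Function using (_∘_; id)
open import Function.Bundles using (_⇔_; mk⇔; Equivalence)
open import Relation.Nullary using (¬_; yes; no; contradiction)
open import Relation.Binary.PropositionalEquality using (_≡_; refl; sym; trans; cong₂; subst; subst₂)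
open import Relation.Binary.Construct.Closure.ReflexiveTransitive using (ε; _◅_; _◅◅_)

⋁ : ∀ {n} m → (Fin m → Formula n) → Formula n
⋁ zero    φ = fls
⋁ (suc m) φ = φ zero ∨ ⋁ m (φ ∘ suc)

⋀ : ∀ {n} m → (Fin m → Formula n) → Formula n
⋀ zero    φ = fls ⇒ fls
⋀ (suc m) φ = φ zero ∧ ⋀ m (φ ∘ suc)

∀ⁿ : ∀ m {n} → Formula (m + n) → Formula n
∀ⁿ zero    φ = φ
∀ⁿ (suc m) φ = ∀ⁿ m (all φ)

prepend : ∀ {A : Set} m {n} → (Fin m → A) → (Fin n → A) → Fin (m + n) → A
prepend zero    ys ρ = ρ
prepend (suc m) ys ρ = extend (prepend m (ys ∘ suc) ρ) (ys zero)

prepend-↑ˡ : ∀ {A : Set} m {n} (ys : Fin m → A) (ρ : Fin n → A) i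
             → prepend m ys ρ (i ↑ˡ n) ≡ ys i
prepend-↑ˡ (suc m) ys ρ zero    = refl
prepend-↑ˡ (suc m) ys ρ (suc i) = prepend-↑ˡ m (ys ∘ suc) ρ i

prepend-↑ʳ : ∀ {A : Set} m {n} (ys : Fin m → A) (ρ : Fin n → A) i
             → prepend m ys ρ (m ↑ʳ i) ≡ ρ i
prepend-↑ʳ zero    ys ρ i = refl
prepend-↑ʳ (suc m) ys ρ i = prepend-↑ʳ m (ys ∘ suc) ρ i

module _ (M : Structure) where

  Sat-⋁ : ∀ {n} m (φ : Fin m → Formula n) ρ → Sat M (⋁ m φ) ρ ⇔ ∃ λ j → Sat M (φ j) ρ
  Sat-⋁ zero    φ ρ = mk⇔ (λ ()) λ ()
  Sat-⋁ (suc m) φ ρ = mk⇔ to from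
    where
    ih = Sat-⋁ m (φ ∘ suc) ρ
    to : Sat M (⋁ (suc m) φ) ρ → ∃ λ j → Sat M (φ j) ρ
    to (inj₁ h) = zero , h
    to (inj₂ h) = Product.map suc id (Equivalence.to ih h)
    from : (∃ λ j → Sat M (φ j) ρ) → Sat M (⋁ (suc m) φ) ρ
    from (zero  , h) = inj₁ h
    from (suc j , h) = inj₂ (Equivalence.from ih (j , h))

  Sat-⋀ : ∀ {n} m (φ : Fin m → Formula n) ρ → Sat M (⋀ m φ) ρ ⇔ (∀ j → Sat M (φ j) ρ)
  Sat-⋀ zero    φ ρ = mk⇔ (λ _ ()) (λ _ → id)
  Sat-⋀ (suc m) φ ρ = mk⇔ to from
    where
    ih = Sat-⋀ m (φ ∘ suc) ρ
    to : Sat M (⋀ (suc m) φ) ρ → ∀ j → Sat M (φ j) ρ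
    to (h , _) zero    = h
    to (_ , h) (suc j) = Equivalence.to ih h j
    from : (∀ j → Sat M (φ j) ρ) → Sat M (⋀ (suc m) φ) ρ
    from h = h zero , Equivalence.from ih (h ∘ suc)

  Sat-∀ⁿ : ∀ m {n} (φ : Formula (m + n)) ρ
           → Sat M (∀ⁿ m φ) ρ ⇔ (∀ ys → Sat M φ (prepend m ys ρ))
  Sat-∀ⁿ zero    φ ρ = mk⇔ (λ h _ → h) (λ h → h λ ())
  Sat-∀ⁿ (suc m) φ ρ = mk⇔
    (λ h ys → Equivalence.to ih h (ys ∘ suc) (ys zero))
    (λ h → Equivalence.from ih λ ys a → h (extend ys a))
    where ih = Sat-∀ⁿ m (all φ) ρ

_⊨_ : Structure → Formula 0 → Set
M ⊨ φ = Sat M φ λ ()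

-- In Γ this says that x and y lie in the same G_n.
SameLevel : (M : Structure) → Carrier M → Carrier M → Set
SameLevel M x y = ¬ Tri M x y × ¬ Tri M y x

sameLevel : ∀ {n} → Fin n → Fin n → Formula n
sameLevel i j = (relT i j ⇒ fls) ∧ (relT j i ⇒ fls)

sameLevel-refl : Formula 0
sameLevel-refl = all (sameLevel zero zero)

sameLevel-adj : Formula 0
sameLevel-adj = all (all (all (sameLevel (suc (suc zero)) (suc zero)
  ⇒ ((relE (suc zero) zero ∨ relE zero (suc zero)) ⇒ sameLevel (suc (suc zero)) zero))))

hasUNeighbour : Formula 0
hasUNeighbour = all (relU zero ∨ ex (relU zero ∧ relE zero (suc zero)))

module _ (M : Structure) (refl≈ : M ⊨ sameLevel-refl) (adj≈ : M ⊨ sameLevel-adj) where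

  sameLevel-along : ∀ {x y z} → SameLevel M x y → Conn M y z → SameLevel M x z
  sameLevel-along x≈y ε                     = x≈y
  sameLevel-along x≈y (_◅_ {j = y'} e path) = sameLevel-along (adj≈ _ _ y' x≈y e) path

  conn⇒sameLevel : ∀ {x y} → Conn M x y → SameLevel M x y
  conn⇒sameLevel = sameLevel-along (refl≈ _)

-- Variable 0 is the level marker p, variable 1 + t is the listed element q t.
classesBelow : ∀ L → Formula (suc L)
classesBelow L = all (relT zero (suc zero)
  ⇒ all (sameLevel (suc zero) zero ⇒ ⋁ L λ t → zero ≐ suc (suc (suc t))))

ClassesBelow : (M : Structure) {L : ℕ} → Carrier M → (Fin L → Carrier M) → Set
ClassesBelow M p qs = ∀ x → Tri M x p → ∀ y → SameLevel M x y → ∃ λ t → y ≡ qs t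

Sat-classesBelow : ∀ M L ρ → Sat M (classesBelow L) ρ ⇔ ClassesBelow M (ρ zero) (ρ ∘ suc)
Sat-classesBelow M L ρ = mk⇔
  (λ h x x◁p y x≈y → Equivalence.to (Sat-⋁ M L _ _) (h x x◁p y x≈y))
  (λ h x x◁p y x≈y → Equivalence.from (Sat-⋁ M L _ _) (h x x◁p y x≈y))

-- The free variables are u₀ … u_{K-1}, then x, then the level marker p.
commonNeighbourOf : ∀ K → Formula (K + 2)
commonNeighbourOf K =
  ⋀ K (λ i → relU (u i) ∧ sameLevel (K ↑ʳ zero) (u i))
    ⇒ ex (relV zero ∧ ⋀ K λ i → relE (suc (u i)) zero)
  where
  u : Fin K → Fin (K + 2)
  u i = i ↑ˡ 2

commonNeighbours : ℕ → Formula 1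
commonNeighbours K = all ((relT zero (suc zero) ⇒ fls) ⇒ ∀ⁿ K (commonNeighbourOf K))

HasCommonNeighbour : (M : Structure) {K : ℕ} → Carrier M → (Fin K → Carrier M) → Set
HasCommonNeighbour M x us =
  (∀ i → U M (us i) × SameLevel M x (us i)) → ∃ λ v → V M v × ∀ i → E M (us i) v

CommonNeighbours : (M : Structure) → ℕ → Carrier M → Set
CommonNeighbours M K p = ∀ x → ¬ Tri M x p → (us : Fin K → Carrier M) → HasCommonNeighbour M x us

Sat-commonNeighbourOf : ∀ M K us x (ρ : Fin 1 → Carrier M)
  → Sat M (commonNeighbourOf K) (prepend K us (extend ρ x)) ⇔ HasCommonNeighbour M x us
Sat-commonNeighbourOf M K us x ρ = mk⇔ to from
  where
  σ = prepend K us (extend ρ x)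
  σ-u : ∀ i → σ (i ↑ˡ 2) ≡ us i
  σ-u = prepend-↑ˡ K us (extend ρ x)
  σ-x : σ (K ↑ʳ zero) ≡ x
  σ-x = prepend-↑ʳ K us (extend ρ x) zero
  Hyp : Carrier M → Carrier M → Set
  Hyp a b = U M b × SameLevel M a b

  to : Sat M (commonNeighbourOf K) σ → HasCommonNeighbour M x us
  to h us-ok =
    let v , Vv , es = h (Equivalence.from (Sat-⋀ M K _ σ) λ i →
                          subst₂ Hyp (sym σ-x) (sym (σ-u i)) (us-ok i))
    in v , Vv , λ i → subst (λ a → E M a v) (σ-u i) (Equivalence.to (Sat-⋀ M K _ _) es i)

  from : HasCommonNeighbour M x us → Sat M (commonNeighbourOf K) σ
  from h us-ok =
    let v , Vv , es = h λ i → subst₂ Hyp σ-x (σ-u i) (Equivalence.to (Sat-⋀ M K _ σ) us-ok i)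
    in v , Vv , Equivalence.from (Sat-⋀ M K _ _) λ i →
                  subst (λ a → E M a v) (sym (σ-u i)) (es i)

Sat-commonNeighbours : ∀ M K ρ → Sat M (commonNeighbours K) ρ ⇔ CommonNeighbours M K (ρ zero)
Sat-commonNeighbours M K ρ = mk⇔
  (λ h x x-high us → Equivalence.to (matrix us x) (Equivalence.to (block x) (h x x-high) us))
  (λ h x x-high → Equivalence.from (block x) λ us → Equivalence.from (matrix us x) (h x x-high us))
  where
  block = λ x → Sat-∀ⁿ M K (commonNeighbourOf K) (extend ρ x)
  matrix = λ us x → Sat-commonNeighbourOf M K us x ρ

∣p∪q∣≤∣p∣+∣q∣ : ∀ {n} (p q : Subset n) → ∣ p ∪ q ∣ ≤ ∣ p ∣ + ∣ q ∣
∣p∪q∣≤∣p∣+∣q∣ []            []            = z≤n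
∣p∪q∣≤∣p∣+∣q∣ (inside ∷ p)  (t ∷ q)       =
  s≤s (≤-trans (∣p∪q∣≤∣p∣+∣q∣ p q) (+-monoʳ-≤ ∣ p ∣ (∣p∣≤∣x∷p∣ t q)))
∣p∪q∣≤∣p∣+∣q∣ (outside ∷ p) (inside ∷ q)  =
  ≤-trans (s≤s (∣p∪q∣≤∣p∣+∣q∣ p q)) (≤-reflexive (sym (+-suc ∣ p ∣ ∣ q ∣)))
∣p∪q∣≤∣p∣+∣q∣ (outside ∷ p) (outside ∷ q) = ∣p∪q∣≤∣p∣+∣q∣ p q

image : ∀ {m n} → (Fin m → Fin n) → Subset n
image {zero}  a = ∅
image {suc m} a = ⁅ a zero ⁆ ∪ image (a ∘ suc)

∈-image : ∀ {m n} (a : Fin m → Fin n) i → a i ∈ₛ image a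
∈-image a zero    = x∈p∪q⁺ (inj₁ (x∈⁅x⁆ (a zero)))
∈-image a (suc i) = x∈p∪q⁺ (inj₂ (∈-image (a ∘ suc) i))

∣image∣≤ : ∀ {m n} (a : Fin m → Fin n) → ∣ image a ∣ ≤ m
∣image∣≤ {zero}  {n} a = subst (_≤ 0) (sym (∣⊥∣≡0 n)) z≤n
∣image∣≤ {suc m} a     = ≤-trans (∣p∪q∣≤∣p∣+∣q∣ ⁅ a zero ⁆ _)
  (subst (λ k → k + ∣ image (a ∘ suc) ∣ ≤ suc m) (sym (∣⁅x⁆∣≡1 (a zero)))
    (s≤s (∣image∣≤ (a ∘ suc))))

0<∣image∣ : ∀ {m n} (a : Fin (suc m) → Fin n) → 0 < ∣ image a ∣
0<∣image∣ a =
  subst (_≤ ∣ image a ∣) (∣⁅x⁆∣≡1 (a zero)) (∣p∣≤∣p∪q∣ ⁅ a zero ⁆ (image (a ∘ suc)))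

0<∣p∣⇒Nonempty : ∀ {n} (p : Subset n) → 0 < ∣ p ∣ → Nonempty p
0<∣p∣⇒Nonempty (inside  ∷ p) _ = zero , here
0<∣p∣⇒Nonempty (outside ∷ p) h = Product.map suc there (0<∣p∣⇒Nonempty p h)

allSubsets : ∀ n → List (Subset n)
allSubsets zero    = [ [] ]
allSubsets (suc n) = cartesianProductWith _∷_ (inside ∷ outside ∷ []) (allSubsets n)

∈-allSubsets : ∀ {n} (p : Subset n) → p ∈ allSubsets n
∈-allSubsets []            = here refl
∈-allSubsets (inside  ∷ p) = ∈-cartesianProductWith⁺ _∷_ {xs = inside ∷ outside ∷ []}
                               (here refl) (∈-allSubsets p)
∈-allSubsets (outside ∷ p) = ∈-cartesianProductWith⁺ _∷_ {xs = inside ∷ outside ∷ []}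
                               (there (here refl)) (∈-allSubsets p)

Γ-sameLevel⇒index≡ : ∀ {x y} → SameLevel Γ x y → index x ≡ index y
Γ-sameLevel⇒index≡ (x⋪y , y⋪x) = ≤-antisym (≮⇒≥ y⋪x) (≮⇒≥ x⋪y)

Γ-index≡⇒sameLevel : ∀ {x y} → index x ≡ index y → SameLevel Γ x y
Γ-index≡⇒sameLevel x≡y = <-irrefl x≡y , <-irrefl (sym x≡y)

Γ-adj⇒index≡ : ∀ {x y} → Adj Γ x y → index x ≡ index y
Γ-adj⇒index≡ (inj₁ (edge _)) = refl
Γ-adj⇒index≡ (inj₂ (edge _)) = refl

Γ-sameLevel-refl : Γ ⊨ sameLevel-refl
Γ-sameLevel-refl x = Γ-index≡⇒sameLevel {x} {x} refl

Γ-sameLevel-adj : Γ ⊨ sameLevel-adj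
Γ-sameLevel-adj x y z x≈y y~z =
  Γ-index≡⇒sameLevel {x} {z} (trans (Γ-sameLevel⇒index≡ {x} {y} x≈y) (Γ-adj⇒index≡ y~z))

Γ-hasUNeighbour : Γ ⊨ hasUNeighbour
Γ-hasUNeighbour (uvert k a)     = inj₁ isU
Γ-hasUNeighbour (vvert k s p q) =
  let a , a∈s = 0<∣p∣⇒Nonempty s p in inj₂ (uvert k a , isU , edge a∈s)

uvert-at : ∀ {y n} → ΓU y → index y ≡ n → ∃ λ a → y ≡ uvert n a
uvert-at {uvert k a} isU refl = a , refl

vvertsOn : ∀ k → Subset (Nn k ^ 3) → List ΓElem
vvertsOn k s with 1 ≤? ∣ s ∣ | ∣ s ∣ ≤? Nn k
... | yes p | yes q = [ vvert k s p q ]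
... | _     | _     = []

∈-vvertsOn : ∀ k s p q → vvert k s p q ∈ vvertsOn k s
∈-vvertsOn k s p q with 1 ≤? ∣ s ∣ | ∣ s ∣ ≤? Nn k
... | yes p′ | yes q′ = here (cong₂ (vvert k s) (≤-irrelevant p p′) (≤-irrelevant q q′))
... | no ¬p  | _      = contradiction p ¬p
... | yes _  | no ¬q  = contradiction q ¬q

level : ℕ → List ΓElem
level k = map (uvert k) (allFin _) ++ concatMap (vvertsOn k) (allSubsets _)

∈-level : ∀ y → y ∈ level (index y)
∈-level (uvert k a)     = ∈-++⁺ˡ (∈-map⁺ (uvert k) (∈-allFin a))
∈-level (vvert k s p q) =
  ∈-++⁺ʳ (map (uvert k) (allFin _))
    (∈-concatMap⁺ (vvertsOn k) (lose (∈-allSubsets s) (∈-vvertsOn k s p q)))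

below : ℕ → List ΓElem
below K = concatMap level (upTo K)

∈-below : ∀ {K} y → index y < K → y ∈ below K
∈-below y y<K = ∈-concatMap⁺ level (lose (∈-upTo⁺ y<K) (∈-level y))

levelMarker : ℕ → ΓElem
levelMarker K = uvert K zero

Γ-classesBelow : ∀ K → ClassesBelow Γ (levelMarker K) (lookup (below K))
Γ-classesBelow K x x<K y x≈y = position y∈ , lookup-index y∈
  where
  y∈ = ∈-below y (subst (_< K) (Γ-sameLevel⇒index≡ {x} {y} x≈y) x<K)

Γ-commonNeighbour : ∀ {k} n (as : Fin (suc k) → Fin (Nn n ^ 3)) → suc k ≤ Nn n
                    → ∃ λ v → ΓV v × ∀ i → ΓE (uvert n (as i)) v
Γ-commonNeighbour n as k<Nn =
  vvert n (image as) (0<∣image∣ as) (≤-trans (∣image∣≤ as) k<Nn) , isV , λ i → edge (∈-image as i)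

Γ-commonNeighbours : ∀ k → CommonNeighbours Γ (suc k) (levelMarker (suc k))
Γ-commonNeighbours k x x-high us us-ok =
  let v , Vv , es = Γ-commonNeighbour n (proj₁ ∘ at) (≤-trans (≮⇒≥ x-high) (m≤n+m n 2))
  in v , Vv , λ i → subst (λ u → ΓE u v) (sym (proj₂ (at i))) (es i)
  where
  n = index x
  at : ∀ i → ∃ λ a → us i ≡ uvert n a
  at i = uvert-at (proj₁ (us-ok i)) (sym (Γ-sameLevel⇒index≡ {x} {us i} (proj₂ (us-ok i))))

All-lookup⁻ : ∀ {A : Set} {P : A → Set} (xs : List A) → (∀ i → P (lookup xs i)) → All P xs
All-lookup⁻ {P = P} xs h =
  All.tabulate λ x∈xs → subst P (sym (lookup-index x∈xs)) (h (position x∈xs))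

module ElementaryExtension
  (N : Structure) (f : Carrier Γ → Carrier N) (emb : IsElementaryEmbedding Γ N f) where

  transfer : ∀ {n} (φ : Formula n) {ρ} → Sat Γ φ ρ → Sat N φ (f ∘ ρ)
  transfer φ {ρ} = Equivalence.to (emb φ ρ)

  conn⇒sameLevelᴺ : ∀ {x y} → Conn N x y → SameLevel N x y
  conn⇒sameLevelᴺ = conn⇒sameLevel N (transfer sameLevel-refl {λ ()} Γ-sameLevel-refl)
                                     (transfer sameLevel-adj {λ ()} Γ-sameLevel-adj)

  U-in-component : ∀ c → ∃ λ u → Conn N c u × U N u
  U-in-component c with transfer hasUNeighbour {λ ()} Γ-hasUNeighbour c
  ... | inj₁ Uc           = c , ε , Uc
  ... | inj₂ (u , Uu , e) = u , inj₂ e ◅ ε , Uu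

  classesBelowᴺ : ∀ K → ClassesBelow N (f (levelMarker K)) (f ∘ lookup (below K))
  classesBelowᴺ K = Equivalence.to (Sat-classesBelow N L (f ∘ ρ))
    (transfer (classesBelow L) (Equivalence.from (Sat-classesBelow Γ L ρ) (Γ-classesBelow K)))
    where
    L = length (below K)
    ρ = extend (lookup (below K)) (levelMarker K)

  commonNeighboursᴺ : ∀ k → CommonNeighbours N (suc k) (f (levelMarker (suc k)))
  commonNeighboursᴺ k = Equivalence.to (Sat-commonNeighbours N (suc k) λ _ → f p)
    (transfer (commonNeighbours (suc k))
      (Equivalence.from (Sat-commonNeighbours Γ (suc k) λ _ → p) (Γ-commonNeighbours k)))
    where
    p = levelMarker (suc k)

  infinite⇒above : ∀ {c} → InfiniteComponent N c → ∀ K → ¬ Tri N c (f (levelMarker K))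
  infinite⇒above {c} infinite K c◁p = infinite (map f (below K) , λ y c⇝y →
    let t , y≡ = classesBelowᴺ K c c◁p y (conn⇒sameLevelᴺ c⇝y)
    in subst (_∈ map f (below K)) (sym y≡) (∈-map⁺ f (∈-lookup t)))

lemma4p7 : (ΓNS : Structure) (f : Carrier Γ → Carrier ΓNS)
             → IsElementaryEmbedding Γ ΓNS f → Proper Γ ΓNS f → Countable ΓNS
             → (c : Carrier ΓNS) → InfiniteComponent ΓNS c
             → (F : List (Carrier ΓNS))
             → All (λ u → Conn ΓNS c u × U ΓNS u) F
             → Σ (Carrier ΓNS) (λ v → Conn ΓNS c v × V ΓNS v × All (λ u → E ΓNS u v) F)
lemma4p7 N f emb _ _ c infinite F F-ok = v , c⇝u₀ ◅◅ (inj₁ (All.head edges) ◅ ε) , Vv , All.tail edges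
  where
  open ElementaryExtension N f emb
  u₀-ok = U-in-component c
  u₀ = proj₁ u₀-ok
  c⇝u₀ = proj₁ (proj₂ u₀-ok)

  us-ok : ∀ i → U N (lookup (u₀ ∷ F) i) × SameLevel N c (lookup (u₀ ∷ F) i)
  us-ok i = let c⇝u , Uu = All.lookup (proj₂ u₀-ok ∷ F-ok) (∈-lookup i) in Uu , conn⇒sameLevelᴺ c⇝u

  common = commonNeighboursᴺ (length F) c (infinite⇒above infinite (suc (length F)))
             (lookup (u₀ ∷ F)) us-ok
  v = proj₁ common
  Vv = proj₁ (proj₂ common)

  edges : All (λ u → E N u v) (u₀ ∷ F)
  edges = All-lookup⁻ (u₀ ∷ F) (proj₂ (proj₂ common))
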